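{- Let $k\ge 2$ be an integer and let $$p_k(X)=X^k-2\left(X^{k-2}+X^{k-3}+\cdots+X+1\right).$$ For $n\ge k$ let $\tau_{n,k}=\sum_{j=1}^{n-k+1}X_jX_{j+1}\cdots X_{j+k-1}$ be the trapezoid Boolean function in the $n$ variables $X_1,\dots,X_n$. Then the sequence $\{S(\tau_{n,k})\}_{n=k}^{\infty}$ satisfies the homogeneous linear recurrence with integer coefficients whose characteristic polynomial is $p_k(X)$, i.e. $S(\tau_{n,k})=2\sum_{l=2}^{k}S(\tau_{n-l,k})$ whenever all indices are at least $k$.
   Context: A Boolean function in $n$ variables is a map $\mathbb{F}_2^n\to\mathbb{F}_2$, identified with its polynomial (algebraic normal form) in $X_1,\dots,X_n$. Its exponential sum is $S(F)=\sum_{\mathbf{x}\in\mathbb{F}_2^n}(-1)^{F(\mathbf{x})}$. A sequence $(a_n)$ satisfies the homogeneous linear recurrence with characteristic polynomial $X^d-\sum_{i=1}^d c_iX^{d-i}$ if $a_n=\sum_{i=1}^d c_ia_{n-i}$ for all admissible $n$. -}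

module Defs where

open import Data.Bool using (Bool; true; false; _∧_; _xor_)
open import Data.Nat using (ℕ; zero; suc; _+_; _∸_)
open import Data.Integer using (ℤ; +_; -_) renaming (_+_ to _+ℤ_; _*_ to _*ℤ_)
open import Data.List using (List; []; _∷_; map; length; replicate; _++_; foldr; upTo; applyUpTo)
open import Data.Vec using (Vec; []; _∷_; toList)
open import Data.Product using (_×_; _,_)

-- Points of F₂ⁿ: vectors of n bits; the bit at position i (0-based) is X_{i+1}.
BoolFun : ℕ → Set
BoolFun n = Vec Bool n → Bool

allPoints : (n : ℕ) → List (Vec Bool n)
allPoints zero = [] ∷ []
allPoints (suc n) = map (false ∷_) (allPoints n) ++ map (true ∷_) (allPoints n)

sign : Bool → ℤ
sign false = + 1
sign true = - (+ 1)

sumℤ : List ℤ → ℤ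
sumℤ = foldr _+ℤ_ (+ 0)

S : {n : ℕ} → BoolFun n → ℤ
S {n} F = sumℤ (map (λ x → sign (F x)) (allPoints n))

-- i-th bit (0-based) of a list of bits, false if out of range
-- (never out of range in the uses below).
bit : List Bool → ℕ → Bool
bit [] _ = false
bit (b ∷ _) zero = b
bit (_ ∷ bs) (suc i) = bit bs i

-- Monomial X_{j+1} X_{j+2} ⋯ X_{j+k} (0-based start j), evaluated at x.
window : List Bool → ℕ → ℕ → Bool
window xs j k = foldr _∧_ true (applyUpTo (λ i → bit xs (j + i)) k)

τ : (n k : ℕ) → BoolFun n
τ n k x = foldr _xor_ false (applyUpTo (λ j → window (toList x) j k) (suc (n ∸ k)))

-- Polynomials with integer coefficients as ascending coefficient lists
-- [a₀, a₁, …, a_d] meaning a₀ + a₁ X + ⋯ + a_d X^d.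
coeff : List ℤ → ℕ → ℤ
coeff [] _ = + 0
coeff (a ∷ _) zero = a
coeff (_ ∷ as) (suc i) = coeff as i

deg : List ℤ → ℕ
deg P = length P ∸ 1

p : ℕ → List ℤ
p k = replicate (k ∸ 1) (- (+ 2)) ++ (+ 0 ∷ + 1 ∷ [])

-- A sequence (a_n)_{n ≥ start} satisfies the homogeneous linear recurrence with
-- (monic) characteristic polynomial P = X^d − Σ_{i=1}^d c_i X^{d−i}, i.e.
-- c_i = − coeff P (d − i), if a_n = Σ_{i=1}^d c_i a_{n−i} for every admissible n
-- (all indices n, n−1, …, n−d are ≥ start).
SatisfiesRecurrence : (ℕ → ℤ) → ℕ → List ℤ → Set
SatisfiesRecurrence a start P =
  ∀ n → start + deg P Data.Nat.≤ n →
    a n ≡ sumℤ (applyUpTo (λ i → (- coeff P (deg P ∸ suc i)) *ℤ a (n ∸ suc i)) (deg P))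
  where open import Relation.Binary.PropositionalEquality using (_≡_)

-- Let a(n) = S(τ_{n,k}) and let c_r(n) be the exponential sum of τ_{r+n,k} over the points
-- whose first r coordinates are 1. Split on the first free coordinate. For r ≤ k−1, a 0 there
-- kills every monomial meeting the block of ones, so c_r(n+1) = a(n) + c_{r+1}(n); for
-- r ≥ k−1, one more leading 1 switches on exactly one new monomial, so c_{r+1} = −c_r.
-- Unrolling the first identity gives a(k−1+m) = W(m) + c_{k−1}(m), W(m) = a(m) + ⋯ + a(m+k−2);
-- comparing this at m and m+1 via c_{k−1}(m+1) = a(m) − c_{k−1}(m) yields a(k+m) = 2 W(m).
module Submission where

open import Defs
open import Data.Bool using (Bool; true; false; not; _∧_; _xor_)
open import Data.Bool.Properties using (∧-zeroʳ)
open import Data.Integer using (ℤ; +_; -_) renaming (_+_ to _+ℤ_; _*_ to _*ℤ_)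
import Data.Integer.Properties as ℤ
open import Data.Integer.Tactic.RingSolver using (solve-∀)
open import Data.List using (List; []; _∷_; map; length; replicate; _++_; foldr; applyUpTo)
open import Data.List.Properties using (map-++; map-∘; map-cong; map-applyUpTo)
open import Data.Nat using (ℕ; zero; suc; _+_; _∸_; _≤_; _<_; s≤s; z<s; _≤?_)
open import Data.Nat.Properties
  using (≤-pred; <⇒≤; ≰⇒>; ≤-refl; ≤-trans; m≤m+n; +-suc; +-identityʳ; +-∸-assoc;
         m≤n⇒m∸n≡0; ∸-monoʳ-<; m≤n⇒∃[o]m+o≡n)
open import Data.Product using (_,_)
open import Data.Vec using (Vec; _∷_; toList)
open import Data.Vec.Properties using (length-toList)
open import Relation.Binary.PropositionalEquality
open import Relation.Nullary using (yes; no)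

sumℤ-++ : ∀ xs ys → sumℤ (xs ++ ys) ≡ sumℤ xs +ℤ sumℤ ys
sumℤ-++ []       ys = sym (ℤ.+-identityˡ (sumℤ ys))
sumℤ-++ (x ∷ xs) ys rewrite sumℤ-++ xs ys = sym (ℤ.+-assoc x (sumℤ xs) (sumℤ ys))

sumℤ-map-neg : ∀ xs → sumℤ (map -_ xs) ≡ - sumℤ xs
sumℤ-map-neg []       = refl
sumℤ-map-neg (x ∷ xs) rewrite sumℤ-map-neg xs = sym (ℤ.neg-distrib-+ x (sumℤ xs))

sumℤ-map-*ˡ : ∀ c xs → sumℤ (map (c *ℤ_) xs) ≡ c *ℤ sumℤ xs
sumℤ-map-*ˡ c []       = sym (ℤ.*-zeroʳ c)
sumℤ-map-*ˡ c (x ∷ xs) rewrite sumℤ-map-*ˡ c xs = sym (ℤ.*-distribˡ-+ c x (sumℤ xs))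

applyUpTo-cong : ∀ {A : Set} {f g : ℕ → A} n →
                 (∀ {i} → i < n → f i ≡ g i) → applyUpTo f n ≡ applyUpTo g n
applyUpTo-cong zero    f≡g = refl
applyUpTo-cong (suc n) f≡g = cong₂ _∷_ (f≡g z<s) (applyUpTo-cong n (λ i<n → f≡g (s≤s i<n)))

replicate-++-∷ : ∀ {A : Set} r (x : A) xs → replicate r x ++ x ∷ xs ≡ x ∷ replicate r x ++ xs
replicate-++-∷ zero    x xs = refl
replicate-++-∷ (suc r) x xs = cong (x ∷_) (replicate-++-∷ r x xs)

sign-not : ∀ b → sign (not b) ≡ - sign b
sign-not false = refl
sign-not true  = refl

S-cong : ∀ {n} {F G : BoolFun n} → (∀ x → F x ≡ G x) → S F ≡ S G
S-cong {n} F≡G = cong sumℤ (map-cong (λ x → cong sign (F≡G x)) (allPoints n))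

S-not : ∀ {n} (F : BoolFun n) → S (λ x → not (F x)) ≡ - S F
S-not {n} F = begin
  sumℤ (map (λ x → sign (not (F x))) P)   ≡⟨ cong sumℤ (map-cong (λ x → sign-not (F x)) P) ⟩
  sumℤ (map (λ x → - sign (F x)) P)       ≡⟨ cong sumℤ (map-∘ P) ⟩
  sumℤ (map -_ (map (λ x → sign (F x)) P)) ≡⟨ sumℤ-map-neg (map (λ x → sign (F x)) P) ⟩
  - S F                                    ∎
  where
  open ≡-Reasoning
  P = allPoints n

S-cons : ∀ {n} (F : BoolFun (suc n)) →
         S F ≡ S (λ x → F (false ∷ x)) +ℤ S (λ x → F (true ∷ x))
S-cons {n} F = begin
  sumℤ (map f (map (false ∷_) P ++ map (true ∷_) P))
    ≡⟨ cong sumℤ (map-++ f (map (false ∷_) P) _) ⟩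
  sumℤ (map f (map (false ∷_) P) ++ map f (map (true ∷_) P))
    ≡⟨ sumℤ-++ (map f (map (false ∷_) P)) _ ⟩
  sumℤ (map f (map (false ∷_) P)) +ℤ sumℤ (map f (map (true ∷_) P))
    ≡⟨ sym (cong₂ _+ℤ_ (cong sumℤ (map-∘ P)) (cong sumℤ (map-∘ P))) ⟩
  S (λ x → F (false ∷ x)) +ℤ S (λ x → F (true ∷ x))
    ∎
  where
  open ≡-Reasoning
  P = allPoints n
  f : Vec Bool (suc n) → ℤ
  f x = sign (F x)

Σ-window : (ℕ → ℤ) → ℕ → ℕ → ℤ
Σ-window a j m = sumℤ (applyUpTo (λ i → a (j + m ∸ suc i)) j)

Σ-window-slide : ∀ a j m → Σ-window a j (suc m) +ℤ a m ≡ a (j + m) +ℤ Σ-window a j m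
Σ-window-slide a zero    m = trans (ℤ.+-identityˡ (a m)) (sym (ℤ.+-identityʳ (a m)))
Σ-window-slide a (suc j) m = begin
  (a (j + suc m) +ℤ Σ-window a j (suc m)) +ℤ a m   ≡⟨ ℤ.+-assoc (a (j + suc m)) _ _ ⟩
  a (j + suc m) +ℤ (Σ-window a j (suc m) +ℤ a m)   ≡⟨ cong₂ _+ℤ_ (cong a (+-suc j m)) (Σ-window-slide a j m) ⟩
  a (suc (j + m)) +ℤ (a (j + m) +ℤ Σ-window a j m) ∎
  where open ≡-Reasoning

length-p : ∀ j → length (p (suc j)) ≡ suc (suc j)
length-p zero    = refl
length-p (suc j) = cong suc (length-p j)

deg-p : ∀ j → deg (p (suc j)) ≡ suc j
deg-p j = cong (_∸ 1) (length-p j)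

coeff-p-top : ∀ j → coeff (p (suc j)) j ≡ + 0
coeff-p-top zero    = refl
coeff-p-top (suc j) = coeff-p-top j

coeff-p-below : ∀ {i j} → i < j → coeff (p (suc j)) i ≡ - (+ 2)
coeff-p-below {zero}  (s≤s _)   = refl
coeff-p-below {suc i} (s≤s i<j) = coeff-p-below i<j

window-short : ∀ xs m → length xs < m → window xs 0 m ≡ false
window-short []       (suc m) _         = refl
window-short (x ∷ xs) (suc m) (s≤s len<m) rewrite window-short xs m len<m = ∧-zeroʳ x

window-ones : ∀ r m xs → m ≤ r → window (replicate r true ++ xs) 0 m ≡ true
window-ones r       zero    xs _         = refl
window-ones (suc r) (suc m) xs (s≤s m≤r) = window-ones r m xs m≤r

window-ones-false : ∀ r m xs → r < m → window (replicate r true ++ false ∷ xs) 0 m ≡ false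
window-ones-false zero    (suc m) xs _         = refl
window-ones-false (suc r) (suc m) xs (s≤s r<m) = window-ones-false r m xs r<m

module Trapezoid (k′ : ℕ) where

  k : ℕ
  k = suc k′

  τList : List Bool → Bool
  τList xs = foldr _xor_ false (applyUpTo (λ j → window xs j k) (suc (length xs ∸ k)))

  τ≡τList : ∀ {n} (x : Vec Bool n) → τ n k x ≡ τList (toList x)
  τ≡τList x rewrite length-toList x = refl

  -- For a list shorter than k both sides reduce to a single window, which is false
  -- because `bit` reads past the end as false.
  τList-cons : ∀ b xs → τList (b ∷ xs) ≡ (b ∧ window xs 0 k′) xor τList xs
  τList-cons b xs with k ≤? length xs
  ... | yes k≤len rewrite +-∸-assoc 1 k≤len = refl
  ... | no k≰len
    rewrite m≤n⇒m∸n≡0 (≤-pred (≰⇒> k≰len)) | m≤n⇒m∸n≡0 (<⇒≤ (≰⇒> k≰len))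
          | window-short xs k (≰⇒> k≰len) = refl

  τList-ones-false : ∀ r xs → r ≤ k′ → τList (replicate r true ++ false ∷ xs) ≡ τList xs
  τList-ones-false zero    xs _   = τList-cons false xs
  τList-ones-false (suc r) xs r<k′
    rewrite τList-cons true (replicate r true ++ false ∷ xs)
          | window-ones-false r k′ xs r<k′ = τList-ones-false r xs (<⇒≤ r<k′)

  τList-ones-flip : ∀ r xs → k′ ≤ r →
                    τList (true ∷ replicate r true ++ xs) ≡ not (τList (replicate r true ++ xs))
  τList-ones-flip r xs k′≤r
    rewrite τList-cons true (replicate r true ++ xs) | window-ones r k′ xs k′≤r = refl

  Sτ : ℕ → ℤ
  Sτ n = S (τ n k)

  τ-after-ones : ℕ → (n : ℕ) → BoolFun n
  τ-after-ones r n x = τList (replicate r true ++ toList x)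

  Sτ-ones : ℕ → ℕ → ℤ
  Sτ-ones r n = S (τ-after-ones r n)

  Sτ-ones-zero : ∀ n → Sτ-ones 0 n ≡ Sτ n
  Sτ-ones-zero n = S-cong {n} (λ x → sym (τ≡τList x))

  Sτ-ones-low : ∀ r n → r ≤ k′ → Sτ-ones r (suc n) ≡ Sτ n +ℤ Sτ-ones (suc r) n
  Sτ-ones-low r n r≤k′ = begin
    S (τ-after-ones r (suc n))
      ≡⟨ S-cons (τ-after-ones r (suc n)) ⟩
    S (λ x → τ-after-ones r (suc n) (false ∷ x)) +ℤ S (λ x → τ-after-ones r (suc n) (true ∷ x))
      ≡⟨ cong₂ _+ℤ_
           (S-cong {n} (λ x → trans (τList-ones-false r (toList x) r≤k′) (sym (τ≡τList x))))
           (S-cong {n} (λ x → cong τList (replicate-++-∷ r true (toList x)))) ⟩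
    Sτ n +ℤ Sτ-ones (suc r) n
      ∎
    where open ≡-Reasoning

  Sτ-ones-high : ∀ r n → k′ ≤ r → Sτ-ones (suc r) n ≡ - Sτ-ones r n
  Sτ-ones-high r n k′≤r = begin
    S (τ-after-ones (suc r) n)          ≡⟨ S-cong {n} (λ x → τList-ones-flip r (toList x) k′≤r) ⟩
    S (λ x → not (τ-after-ones r n x))  ≡⟨ S-not (τ-after-ones r n) ⟩
    - S (τ-after-ones r n)              ∎
    where open ≡-Reasoning

  Sτ-ones-unfold : ∀ j r m → r + j ≡ k′ → Sτ-ones r (j + m) ≡ Σ-window Sτ j m +ℤ Sτ-ones k′ m
  Sτ-ones-unfold zero r m r≡k′ rewrite +-identityʳ r | r≡k′ = sym (ℤ.+-identityˡ _)
  Sτ-ones-unfold (suc j) r m r+j≡k′ = begin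
    Sτ-ones r (suc (j + m))
      ≡⟨ Sτ-ones-low r (j + m) (subst (r ≤_) r+j≡k′ (m≤m+n r (suc j))) ⟩
    Sτ (j + m) +ℤ Sτ-ones (suc r) (j + m)
      ≡⟨ cong (Sτ (j + m) +ℤ_) (Sτ-ones-unfold j (suc r) m (trans (sym (+-suc r j)) r+j≡k′)) ⟩
    Sτ (j + m) +ℤ (Σ-window Sτ j m +ℤ Sτ-ones k′ m)
      ≡⟨ sym (ℤ.+-assoc (Sτ (j + m)) _ _) ⟩
    Σ-window Sτ (suc j) m +ℤ Sτ-ones k′ m
      ∎
    where open ≡-Reasoning

  Sτ-≡-2*Σ-window : ∀ m → Sτ (k + m) ≡ + 2 *ℤ Σ-window Sτ k′ m
  Sτ-≡-2*Σ-window m = begin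
    Sτ (k + m)                          ≡⟨ cong Sτ (sym (+-suc k′ m)) ⟩
    Sτ (k′ + suc m)                     ≡⟨ unfold (suc m) ⟩
    W (suc m) +ℤ d (suc m)              ≡⟨ cong (W (suc m) +ℤ_) d-step ⟩
    W (suc m) +ℤ (Sτ m +ℤ - d m)        ≡⟨ regroup (W (suc m)) (Sτ m) (d m) ⟩
    (W (suc m) +ℤ Sτ m) +ℤ - d m        ≡⟨ cong (_+ℤ - d m) (Σ-window-slide Sτ k′ m) ⟩
    (Sτ (k′ + m) +ℤ W m) +ℤ - d m       ≡⟨ cong (λ t → (t +ℤ W m) +ℤ - d m) (unfold m) ⟩
    ((W m +ℤ d m) +ℤ W m) +ℤ - d m      ≡⟨ cancel (W m) (d m) ⟩
    + 2 *ℤ W m                          ∎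
    where
    open ≡-Reasoning
    W : ℕ → ℤ
    W = Σ-window Sτ k′
    d : ℕ → ℤ
    d = Sτ-ones k′
    unfold : ∀ m → Sτ (k′ + m) ≡ W m +ℤ d m
    unfold m = trans (sym (Sτ-ones-zero (k′ + m))) (Sτ-ones-unfold k′ 0 m refl)
    d-step : d (suc m) ≡ Sτ m +ℤ - d m
    d-step = trans (Sτ-ones-low k′ m ≤-refl) (cong (Sτ m +ℤ_) (Sτ-ones-high k′ m ≤-refl))
    regroup : ∀ a b c → a +ℤ (b +ℤ - c) ≡ (a +ℤ b) +ℤ - c
    regroup = solve-∀
    cancel : ∀ w c → ((w +ℤ c) +ℤ w) +ℤ - c ≡ + 2 *ℤ w
    cancel = solve-∀

  -- The i = 0 term has coefficient −coeff (p k) (k−1) = 0; the others are 2 · Sτ(k+m−2−i).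
  Sτ-recurrence : ∀ m → Sτ (k + m) ≡
    sumℤ (applyUpTo (λ i → (- coeff (p k) (k ∸ suc i)) *ℤ Sτ (k + m ∸ suc i)) k)
  Sτ-recurrence m rewrite coeff-p-top k′ = begin
    Sτ (k + m)
      ≡⟨ Sτ-≡-2*Σ-window m ⟩
    + 2 *ℤ Σ-window Sτ k′ m
      ≡⟨ sym (sumℤ-map-*ˡ (+ 2) (applyUpTo (λ i → Sτ (k′ + m ∸ suc i)) k′)) ⟩
    sumℤ (map (+ 2 *ℤ_) (applyUpTo (λ i → Sτ (k′ + m ∸ suc i)) k′))
      ≡⟨ cong sumℤ (map-applyUpTo _ (+ 2 *ℤ_) k′) ⟩
    sumℤ (applyUpTo (λ i → + 2 *ℤ Sτ (k′ + m ∸ suc i)) k′)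
      ≡⟨ cong sumℤ (applyUpTo-cong k′ λ {i} i<k′ →
           cong (_*ℤ Sτ (k′ + m ∸ suc i)) (sym (cong -_ (coeff-p-below (∸-monoʳ-< z<s i<k′))))) ⟩
    sumℤ (applyUpTo (λ i → (- coeff (p k) (k′ ∸ suc i)) *ℤ Sτ (k′ + m ∸ suc i)) k′)
      ≡⟨ sym (ℤ.+-identityˡ _) ⟩
    + 0 +ℤ sumℤ (applyUpTo (λ i → (- coeff (p k) (k′ ∸ suc i)) *ℤ Sτ (k′ + m ∸ suc i)) k′)
      ∎
    where open ≡-Reasoning

-- The argument works for every k ≥ 1; the hypothesis 2 ≤ k only serves to exclude k = 0.
theorem2p1 : (k : ℕ) → 2 ≤ k →
    SatisfiesRecurrence (λ n → S (τ n k)) k (p k)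
theorem2p1 zero ()
theorem2p1 (suc k′) _ n k+deg≤n
  with m≤n⇒∃[o]m+o≡n (≤-trans (m≤m+n (suc k′) (deg (p (suc k′)))) k+deg≤n)
... | m , refl rewrite deg-p k′ = Trapezoid.Sτ-recurrence k′ m
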